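{- For all $n\ge 5$, $\mathrm{r}_n(1432)=2\,\mathrm{r}_{n-1}(1432)+\mathrm{r}_{n-2}(1432)$.
   Context: $\mathcal{S}_n$ is the set of permutations of $[n]$, $\pi^r$ the reversal of $\pi$. A word $w$ contains $\rho\in\mathcal{S}_k$ if some subsequence $w_{i_1}\cdots w_{i_k}$ ($i_1<\cdots<i_k$) satisfies $w_{i_a}\le w_{i_b}$ iff $\rho_a\le\rho_b$; otherwise it avoids $\rho$. $\mathcal{R}_n=\{\pi\pi^r:\pi\in\mathcal{S}_n\}$ (concatenation of $\pi$ with its reversal), and $\mathrm{r}_n(\rho)$ is the number of members of $\mathcal{R}_n$ avoiding $\rho$. -}

module Defs where

open import Data.Nat using (ℕ; zero; suc; _≤_; _≤?_)
open import Data.List using (List; []; _∷_; _++_; reverse; length; filter; map; concatMap; upTo; lookup)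
open import Data.List.Relation.Unary.Any using (Any)
open import Data.List.Relation.Unary.All using (All)
open import Data.Fin using (Fin)
open import Data.Product using (Σ; _×_; _,_; proj₁; proj₂)
open import Data.Nat.Properties using (_≟_; ≡-irrelevant)
import Data.Fin.Properties as FinP
import Data.List.Relation.Unary.Any as AnyP
open import Function.Bundles using (mk⇔; Equivalence)
open import Relation.Nullary.Decidable using (map′; _×-dec_; _→-dec_)
open import Data.Fin using (cast)
open import Relation.Binary.PropositionalEquality using (_≡_)
open import Function.Bundles using (_⇔_)
open import Relation.Nullary using (¬_)
open import Relation.Nullary.Decidable using (Dec; yes; no; ¬?)

insertions : ℕ → List ℕ → List (List ℕ)
insertions x [] = (x ∷ []) ∷ []
insertions x (y ∷ ys) = (x ∷ y ∷ ys) ∷ map (y ∷_) (insertions x ys)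

-- S n : all permutations of [n] = {1,…,n}, each listed exactly once,
-- written in one-line notation as lists of naturals.
S : ℕ → List (List ℕ)
S zero = [] ∷ []
S (suc n) = concatMap (insertions (suc n)) (S n)

-- All subsequences w_{i_1} … w_{i_k} (i_1 < … < i_k) of a word
-- (listed with multiplicity; only used for existence).
subseqs : List ℕ → List (List ℕ)
subseqs [] = [] ∷ []
subseqs (x ∷ xs) = map (x ∷_) (subseqs xs) ++ subseqs xs

OrderIso : List ℕ → List ℕ → Set
OrderIso u ρ = Σ (length u ≡ length ρ) λ eq →
  (a b : Fin (length u)) →
    (lookup u a ≤ lookup u b) ⇔ (lookup ρ (cast eq a) ≤ lookup ρ (cast eq b))

Contains : List ℕ → List ℕ → Set
Contains w ρ = Any (λ u → OrderIso u ρ) (subseqs w)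

Avoids : List ℕ → List ℕ → Set
Avoids w ρ = ¬ Contains w ρ

⇔? : {A B : Set} → Dec A → Dec B → Dec (A ⇔ B)
⇔? a b = map′ (λ p → mk⇔ (proj₁ p) (proj₂ p)) (λ e → Equivalence.to e , Equivalence.from e)
              ((a →-dec b) ×-dec (b →-dec a))

orderIso? : (u ρ : List ℕ) → Dec (OrderIso u ρ)
orderIso? u ρ with length u ≟ length ρ
... | no ne = no (λ p → ne (proj₁ p))
... | yes eq = map′ (λ f → eq , f) (λ p → subst-iso p)
     (FinP.all? λ a → FinP.all? λ b →
        ⇔? (lookup u a ≤? lookup u b) (lookup ρ (cast eq a) ≤? lookup ρ (cast eq b)))
  where
  subst-iso : OrderIso u ρ → (a b : Fin (length u)) →
    (lookup u a ≤ lookup u b) ⇔ (lookup ρ (cast eq a) ≤ lookup ρ (cast eq b))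
  subst-iso (eq′ , f) rewrite ≡-irrelevant eq eq′ = f

avoids? : (w ρ : List ℕ) → Dec (Avoids w ρ)
avoids? w ρ = ¬? (AnyP.any? (λ u → orderIso? u ρ) (subseqs w))

-- r n ρ : number of π ∈ S_n such that π π^r avoids ρ.
-- (π ↦ π π^r is injective, so this equals the number of members of R_n avoiding ρ.)
r : ℕ → List ℕ → ℕ
r n ρ = length (filter (λ π → avoids? (π ++ reverse π) ρ) (S n))

-- Every permutation in S (m + 1) arises from exactly one τ ∈ S m by inserting m + 1,
-- and deleting the maximum of a permutation whose mirror word avoids 1432 keeps it
-- avoiding.  When a maximum x is inserted into α β, the new occurrences of 1432 in
-- the mirror word are the patterns a x c b described by AscentOver and Straddle.
-- This determines the avoiding children of an avoiding τ = y z ⋯ ∈ S m for m ≥ 4: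
-- the child (m+1) τ, which has one avoiding child more than τ; the child y (m+1) z ⋯,
-- which has two avoiding children if y = m and at most one otherwise; and the later
-- insertions, which avoid only if y = m and then have exactly two avoiding children.
-- With t m the number of avoiding τ ∈ S m starting with m and e m the number with
-- exactly one avoiding child, summing over S m gives
--   r (m+2) + 2 r m ≡ 3 r (m+1) + t m + e m,   t (m+1) ≡ r m,   e (m+1) + e m + t m ≡ r m,
-- and eliminating t and e yields the recurrence.  The case n = 5 and the identity
-- r 5 + t 4 + e 4 ≡ 3 r 4 that starts the elimination are evaluated.

module Submission where

open import Defs
open import Data.Empty using (⊥; ⊥-elim)
open import Data.Fin using (Fin; zero; suc)
open import Data.List using (List; []; _∷_; _++_; reverse; length; filter; map; concatMap)
open import Data.List.Properties using (reverse-++; unfold-reverse; ++-assoc; map-++; map-∘)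
open import Data.List.Membership.Propositional using (_∈_; _∉_)
open import Data.List.Membership.Propositional.Properties using (∈-++⁺ˡ; ∈-++⁺ʳ; ∈-++⁻; ∈-map⁻; ∈-concat⁻′)
open import Data.List.Relation.Binary.Sublist.Propositional using (_⊆_; []; _∷_; _∷ʳ_; ⊆-refl; ⊆-trans; from∈; to∈)
open import Data.List.Relation.Binary.Sublist.Propositional.Properties using (∷ˡ⁻; ∷ʳ⁻; ++⁺; ++⁺ˡ; ++⁺ʳ; reverse⁺; reverse⁻)
open import Data.List.Relation.Unary.All using (_∷_)
import Data.List.Relation.Unary.All.Properties as All
open import Data.List.Relation.Unary.AllPairs using ([]; _∷_)
open import Data.List.Relation.Unary.Any using (Any; here; there)
import Data.List.Relation.Unary.Any.Properties as Any
open import Data.List.Relation.Unary.Unique.Propositional using (Unique)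
open import Data.Nat using (ℕ; zero; suc; _+_; _*_; _≤_; _<_; _∸_; z≤n; s≤s; _≤?_)
open import Data.Nat.ListAction using (sum)
open import Data.Nat.ListAction.Properties using (sum-++)
open import Data.Nat.Properties
open import Data.Nat.Tactic.RingSolver using (solve-∀)
open import Data.Product using (∃₂; ∃-syntax; _×_; _,_; proj₁; proj₂; map₁)
open import Data.Sum using (_⊎_; inj₁; inj₂)
import Data.Sum as Sum
open import Function using (_∘_)
open import Function.Bundles using (_⇔_; mk⇔; Equivalence)
open import Relation.Binary.PropositionalEquality
open import Relation.Nullary using (¬_; Dec; yes; no)
open import Relation.Nullary.Decidable using (map′)

private
  variable
    A B : Set

⊆-insert : ∀ (p : List A) {q} x → p ++ q ⊆ p ++ x ∷ q
⊆-insert p x = ++⁺ (⊆-refl {x = p}) (x ∷ʳ ⊆-refl)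

⊆-remove : ∀ {x : A} {u} p {q} → x ∉ u → u ⊆ p ++ x ∷ q → u ⊆ p ++ q
⊆-remove []      x∉u (refl ∷ _) = ⊥-elim (x∉u (here refl))
⊆-remove []      x∉u (_ ∷ʳ s)   = s
⊆-remove (y ∷ p) x∉u (refl ∷ s) = refl ∷ ⊆-remove p (x∉u ∘ there) s
⊆-remove (y ∷ p) x∉u (_ ∷ʳ s)   = y ∷ʳ ⊆-remove p x∉u s

∷-⊆-after : ∀ {x : A} {v} p {t} → x ∉ p → x ∷ v ⊆ p ++ x ∷ t → v ⊆ t
∷-⊆-after []      _   (refl ∷ s) = s
∷-⊆-after []      _   (_ ∷ʳ s)   = ∷ˡ⁻ s
∷-⊆-after (y ∷ p) x∉p (refl ∷ s) = ⊥-elim (x∉p (here refl))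
∷-⊆-after (y ∷ p) x∉p (_ ∷ʳ s)   = ∷-⊆-after p (x∉p ∘ there) s

∷-⊆-++⁻ : ∀ {c : A} {u} p {q} → c ∷ u ⊆ p ++ q → c ∈ p ⊎ c ∷ u ⊆ q
∷-⊆-++⁻ []      s          = inj₂ s
∷-⊆-++⁻ (y ∷ p) (refl ∷ s) = inj₁ (here refl)
∷-⊆-++⁻ (y ∷ p) (_ ∷ʳ s)   = Sum.map₁ there (∷-⊆-++⁻ p s)

distinct-∈⇒⊆ : ∀ {u v : A} {l} → u ∈ l → v ∈ l → u ≢ v → u ∷ v ∷ [] ⊆ l ⊎ v ∷ u ∷ [] ⊆ l
distinct-∈⇒⊆ (here refl) (here refl) u≢v = ⊥-elim (u≢v refl)
distinct-∈⇒⊆ (here refl) (there v∈) _   = inj₁ (refl ∷ from∈ v∈)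
distinct-∈⇒⊆ (there u∈) (here refl) _   = inj₂ (refl ∷ from∈ u∈)
distinct-∈⇒⊆ {l = w ∷ _} (there u∈) (there v∈) u≢v =
  Sum.map (w ∷ʳ_) (w ∷ʳ_) (distinct-∈⇒⊆ u∈ v∈ u≢v)

∈-insert⁺ : ∀ {v x : A} α {β} → v ∈ α ++ β → v ∈ α ++ x ∷ β
∈-insert⁺ α v∈ with ∈-++⁻ α v∈
... | inj₁ v∈α = ∈-++⁺ˡ v∈α
... | inj₂ v∈β = ∈-++⁺ʳ α (there v∈β)

∈-insert⁻ : ∀ {v x : A} α {β} → v ∈ α ++ x ∷ β → v ≢ x → v ∈ α ++ β
∈-insert⁻ α v∈ v≢x with ∈-++⁻ α v∈
... | inj₁ v∈α         = ∈-++⁺ˡ v∈α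
... | inj₂ (here v≡x)  = ⊥-elim (v≢x v≡x)
... | inj₂ (there v∈β) = ∈-++⁺ʳ α v∈β

reverse-insert : ∀ (α : List A) x β → reverse (α ++ x ∷ β) ≡ reverse β ++ x ∷ reverse α
reverse-insert α x β = begin
  reverse (α ++ x ∷ β)            ≡⟨ reverse-++ α (x ∷ β) ⟩
  reverse (x ∷ β) ++ reverse α    ≡⟨ cong (_++ reverse α) (unfold-reverse x β) ⟩
  (reverse β ++ x ∷ []) ++ reverse α ≡⟨ ++-assoc (reverse β) (x ∷ []) (reverse α) ⟩
  reverse β ++ x ∷ reverse α      ∎
  where open ≡-Reasoning

++-assoc₃ : ∀ (α β γ δ : List A) → (α ++ β ++ γ) ++ δ ≡ α ++ β ++ γ ++ δ
++-assoc₃ α β γ δ = trans (++-assoc α (β ++ γ) δ) (cong (α ++_) (++-assoc β γ δ))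

unique-insert : ∀ {x : A} p {q} → x ∉ p ++ q → Unique (p ++ q) → Unique (p ++ x ∷ q)
unique-insert []      x∉ u          = All.¬Any⇒All¬ _ x∉ ∷ u
unique-insert (y ∷ p) x∉ (y≢pq ∷ u) =
  All.++⁺ (All.++⁻ˡ p y≢pq) ((λ y≡x → x∉ (here (sym y≡x))) ∷ All.++⁻ʳ p y≢pq)
  ∷ unique-insert p (x∉ ∘ there) u

splits : List A → List (List A × List A)
splits []       = ([] , []) ∷ []
splits (y ∷ ys) = ([] , y ∷ ys) ∷ map (map₁ (y ∷_)) (splits ys)

plug : A → List A × List A → List A
plug x (p , q) = p ++ x ∷ q

subseqs⁺ : ∀ {P : List ℕ → Set} {u w} → u ⊆ w → P u → Any P (subseqs w)
subseqs⁺ [] pu = here pu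
subseqs⁺ {P} (refl ∷ s) pu = Any.++⁺ˡ (Any.map⁺ (subseqs⁺ {λ v → P (_ ∷ v)} s pu))
subseqs⁺ {w = x ∷ xs} (_ ∷ʳ s) pu = Any.++⁺ʳ (map (x ∷_) (subseqs xs)) (subseqs⁺ s pu)

subseqs⁻ : ∀ {P : List ℕ → Set} w → Any P (subseqs w) → ∃[ u ] u ⊆ w × P u
subseqs⁻ [] (here pu) = [] , [] , pu
subseqs⁻ {P} (x ∷ xs) any with Any.++⁻ (map (x ∷_) (subseqs xs)) any
... | inj₁ any′ = let u , s , pu = subseqs⁻ {λ v → P (x ∷ v)} xs (Any.map⁻ any′) in x ∷ u , refl ∷ s , pu
... | inj₂ any′ = let u , s , pu = subseqs⁻ xs any′ in u , x ∷ʳ s , pu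

-- Occurrences of 1432

ρ : List ℕ
ρ = 1 ∷ 4 ∷ 3 ∷ 2 ∷ []

record Occurrence1432 (w : List ℕ) : Set where
  constructor occurrence
  field
    {a b c d} : ℕ
    a<b : a < b
    b<c : b < c
    c<d : c < d
    embedding : a ∷ d ∷ c ∷ b ∷ [] ⊆ w

occurrence-⊆ : ∀ {u w} → u ⊆ w → Occurrence1432 u → Occurrence1432 w
occurrence-⊆ u⊆w (occurrence a<b b<c c<d s) = occurrence a<b b<c c<d (⊆-trans s u⊆w)

orderIso-1432 : ∀ {a b c d} → a < b → b < c → c < d → OrderIso (a ∷ d ∷ c ∷ b ∷ []) ρ
orderIso-1432 {a} {b} {c} {d} a<b b<c c<d = refl , table
  where
  a<c = <-trans a<b b<c
  b<d = <-trans b<c c<d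
  a<d = <-trans a<b b<d
  1<_ : ∀ k → 1 < 2 + k
  1< _ = s≤s (s≤s z≤n)
  2<_ : ∀ k → 2 < 3 + k
  2< _ = s≤s (s≤s (s≤s z≤n))
  3<4 : 3 < 4
  3<4 = s≤s (s≤s (s≤s (s≤s z≤n)))
  same-≤ : ∀ {x y p q : ℕ} → x < y → p < q → (x ≤ y) ⇔ (p ≤ q)
  same-≤ x<y p<q = mk⇔ (λ _ → <⇒≤ p<q) (λ _ → <⇒≤ x<y)
  same-≰ : ∀ {x y p q : ℕ} → y < x → q < p → (x ≤ y) ⇔ (p ≤ q)
  same-≰ y<x q<p = mk⇔ (⊥-elim ∘ <⇒≱ y<x) (⊥-elim ∘ <⇒≱ q<p)
  same-refl : ∀ {x p : ℕ} → (x ≤ x) ⇔ (p ≤ p)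
  same-refl = mk⇔ (λ _ → ≤-refl) (λ _ → ≤-refl)
  table : (i j : Fin 4) → _
  table zero                   zero                   = same-refl
  table zero                   (suc zero)             = same-≤ a<d (1< 2)
  table zero                   (suc (suc zero))       = same-≤ a<c (1< 1)
  table zero                   (suc (suc (suc zero))) = same-≤ a<b (1< 0)
  table (suc zero)             zero                   = same-≰ a<d (1< 2)
  table (suc zero)             (suc zero)             = same-refl
  table (suc zero)             (suc (suc zero))       = same-≰ c<d 3<4
  table (suc zero)             (suc (suc (suc zero))) = same-≰ b<d (2< 1)
  table (suc (suc zero))       zero                   = same-≰ a<c (1< 1)
  table (suc (suc zero))       (suc zero)             = same-≤ c<d 3<4
  table (suc (suc zero))       (suc (suc zero))       = same-refl
  table (suc (suc zero))       (suc (suc (suc zero))) = same-≰ b<c (2< 0)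
  table (suc (suc (suc zero))) zero                   = same-≰ a<b (1< 0)
  table (suc (suc (suc zero))) (suc zero)             = same-≤ b<d (2< 1)
  table (suc (suc (suc zero))) (suc (suc zero))       = same-≤ b<c (2< 0)
  table (suc (suc (suc zero))) (suc (suc (suc zero))) = same-refl

orderIso-1432⁻ : ∀ u → OrderIso u ρ → Occurrence1432 u
orderIso-1432⁻ (a ∷ d ∷ c ∷ b ∷ []) (_ , iso) =
  occurrence (reflects (iso (suc (suc (suc zero))) zero) 2≰1)
             (reflects (iso (suc (suc zero)) (suc (suc (suc zero)))) 3≰2)
             (reflects (iso (suc zero) (suc (suc zero))) 4≰3)
             ⊆-refl
  where
  2≰1 : ¬ 2 ≤ 1
  2≰1 (s≤s ())
  3≰2 : ¬ 3 ≤ 2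
  3≰2 (s≤s (s≤s ()))
  4≰3 : ¬ 4 ≤ 3
  4≰3 (s≤s (s≤s (s≤s ())))
  reflects : ∀ {x y p q : ℕ} → (y ≤ x) ⇔ (q ≤ p) → ¬ q ≤ p → x < y
  reflects iso q≰p = ≰⇒> (q≰p ∘ Equivalence.to iso)
orderIso-1432⁻ [] (() , _)
orderIso-1432⁻ (_ ∷ []) (() , _)
orderIso-1432⁻ (_ ∷ _ ∷ []) (() , _)
orderIso-1432⁻ (_ ∷ _ ∷ _ ∷ []) (() , _)
orderIso-1432⁻ (_ ∷ _ ∷ _ ∷ _ ∷ _ ∷ _) (() , _)

contains⇔occurrence : ∀ w → Contains w ρ ⇔ Occurrence1432 w
contains⇔occurrence w = mk⇔ to from
  where
  to : Contains w ρ → Occurrence1432 w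
  to c = let u , u⊆w , iso = subseqs⁻ w c in occurrence-⊆ u⊆w (orderIso-1432⁻ u iso)
  from : Occurrence1432 w → Contains w ρ
  from (occurrence a<b b<c c<d s) = subseqs⁺ s (orderIso-1432 a<b b<c c<d)

-- Inserting a maximum into a mirror word

mirror : List ℕ → List ℕ
mirror w = w ++ reverse w

MirrorAvoids : List ℕ → Set
MirrorAvoids w = ¬ Occurrence1432 (mirror w)

Below : ℕ → List ℕ → Set
Below x l = ∀ {v} → v ∈ l → v < x

below⇒∉ : ∀ {x l} → Below x l → x ∉ l
below⇒∉ below x∈l = <-irrefl refl (below x∈l)

∈-mirror⁻ : ∀ {v : ℕ} w → v ∈ mirror w → v ∈ w
∈-mirror⁻ w v∈ with ∈-++⁻ w v∈
... | inj₁ v∈w  = v∈w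
... | inj₂ v∈wʳ = Any.reverse⁻ v∈wʳ

mirror-⊆-insert : ∀ α {β} x → mirror (α ++ β) ⊆ mirror (α ++ x ∷ β)
mirror-⊆-insert α x = ++⁺ (⊆-insert α x) (reverse⁺ (⊆-insert α x))

-- The occurrences of 1432 in the mirror of α x β that use the maximum x as
-- their 4 have the form a x c b: AscentOver when x is the second copy of x,
-- Straddle when it is the first.
record AscentOver (α β : List ℕ) : Set where
  constructor ascentOver
  field
    {a b c} : ℕ
    a<b : a < b
    b<c : b < c
    ascent : b ∷ c ∷ [] ⊆ α
    a∈ : a ∈ α ++ β

record Straddle (α β : List ℕ) : Set where
  constructor straddle
  field
    {a b c} : ℕ
    a<b : a < b
    b<c : b < c
    a∈α : a ∈ α
    c∈β : c ∈ β
    b∈ : b ∈ α ++ β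

mirror-insert : ∀ α (x : ℕ) β → mirror (α ++ x ∷ β) ≡ α ++ x ∷ β ++ reverse β ++ x ∷ reverse α
mirror-insert α x β = trans (cong ((α ++ x ∷ β) ++_) (reverse-insert α x β)) (++-assoc α (x ∷ β) _)

mirror-++ : ∀ α β → mirror (α ++ β) ≡ (α ++ β ++ reverse β) ++ reverse α
mirror-++ α β = begin
  (α ++ β) ++ reverse (α ++ β)      ≡⟨ cong ((α ++ β) ++_) (reverse-++ α β) ⟩
  (α ++ β) ++ reverse β ++ reverse α ≡⟨ ++-assoc α β _ ⟩
  α ++ β ++ reverse β ++ reverse α   ≡⟨ ++-assoc₃ α β (reverse β) (reverse α) ⟨
  (α ++ β ++ reverse β) ++ reverse α ∎
  where open ≡-Reasoning

mirror-remove : ∀ {x : ℕ} {u} α β → x ∉ u → u ⊆ mirror (α ++ x ∷ β) → u ⊆ mirror (α ++ β)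
mirror-remove {x} α β x∉u s =
  subst (_ ⊆_) (sym (mirror-++ α β))
    (⊆-remove (α ++ β ++ reverse β) x∉u
      (subst (_ ⊆_) (sym (++-assoc₃ α β (reverse β) (x ∷ reverse α)))
        (⊆-remove α x∉u (subst (_ ⊆_) (mirror-insert α x β) s))))

occurrence-insert⁺ : ∀ {x} α β → Below x (α ++ β) →
  Occurrence1432 (mirror (α ++ β)) ⊎ AscentOver α β ⊎ Straddle α β →
  Occurrence1432 (mirror (α ++ x ∷ β))
occurrence-insert⁺ α β _ (inj₁ occ) = occurrence-⊆ (mirror-⊆-insert α _) occ
occurrence-insert⁺ {x} α β below (inj₂ (inj₁ (ascentOver a<b b<c asc a∈))) =
  occurrence a<b b<c (below (∈-++⁺ˡ (to∈ (∷ˡ⁻ asc))))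
    (subst (_ ⊆_) (cong ((α ++ x ∷ β) ++_) (sym (reverse-insert α x β)))
      (++⁺ (from∈ (∈-insert⁺ α a∈)) (++⁺ˡ (reverse β) (refl ∷ reverse⁺ asc))))
occurrence-insert⁺ {x} α β below (inj₂ (inj₂ (straddle a<b b<c a∈α c∈β b∈))) =
  occurrence a<b b<c (below (∈-++⁺ʳ α c∈β))
    (subst (_ ⊆_) (sym (++-assoc α (x ∷ β) (reverse (α ++ x ∷ β))))
      (++⁺ (from∈ a∈α) (refl ∷ ++⁺ (from∈ c∈β) (from∈ (Any.reverse⁺ (∈-insert⁺ α b∈))))))

occurrence-of-max : ∀ {x a b c} α β → Below x (α ++ β) → a < b → b < c → c < x →
  a ∷ x ∷ c ∷ b ∷ [] ⊆ mirror (α ++ x ∷ β) → AscentOver α β ⊎ Straddle α β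
occurrence-of-max {x} {a} {b} {c} α β below a<b b<c c<x s =
  Sum.[ (λ a∈α → a-in-α a∈α (∷-⊆-after α x∉α (∷ˡ⁻ s₁)))
      , (λ s′ → a-after-x (∷ʳ⁻ (<⇒≢ a<x) s′)) ] (∷-⊆-++⁻ α s₁)
  where
  a<x = <-trans a<b (<-trans b<c c<x)
  x∉α : x ∉ α
  x∉α = below⇒∉ (below ∘ ∈-++⁺ˡ)
  M = β ++ reverse β ++ x ∷ reverse α
  s₁ : a ∷ x ∷ c ∷ b ∷ [] ⊆ α ++ x ∷ M
  s₁ = subst (_ ⊆_) (mirror-insert α x β) s
  b∈ : c ∷ b ∷ [] ⊆ M → b ∈ α ++ β
  b∈ cb = ∈-insert⁻ α (∈-mirror⁻ (α ++ x ∷ β)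
                        (subst (b ∈_) (sym (mirror-insert α x β)) (∈-++⁺ʳ α (there (to∈ (∷ˡ⁻ cb))))))
                      (<⇒≢ (<-trans b<c c<x))
  a-in-α : a ∈ α → c ∷ b ∷ [] ⊆ M → AscentOver α β ⊎ Straddle α β
  a-in-α a∈α cb with ∷-⊆-++⁻ β cb
  ... | inj₁ c∈β = inj₂ (straddle a<b b<c a∈α c∈β (b∈ cb))
  ... | inj₂ cb′ with ∷-⊆-++⁻ (reverse β) cb′
  ... | inj₁ c∈βʳ = inj₂ (straddle a<b b<c a∈α (Any.reverse⁻ c∈βʳ) (b∈ cb))
  ... | inj₂ cb″  = inj₁ (ascentOver a<b b<c (reverse⁻ (∷ʳ⁻ (<⇒≢ c<x) cb″)) (∈-++⁺ˡ a∈α))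
  a-after-x : a ∷ x ∷ c ∷ b ∷ [] ⊆ M → AscentOver α β ⊎ Straddle α β
  a-after-x s″ with ∷-⊆-++⁻ (β ++ reverse β) (subst (_ ⊆_) (sym (++-assoc β (reverse β) _)) s″)
  ... | inj₁ a∈ = inj₁ (ascentOver a<b b<c (reverse⁻ cb) (∈-++⁺ʳ α (∈-mirror⁻ β a∈)))
    where
    cb : c ∷ b ∷ [] ⊆ reverse α
    cb = ∷-⊆-after (β ++ reverse β) (below⇒∉ (below ∘ ∈-++⁺ʳ α ∘ ∈-mirror⁻ β))
           (∷ˡ⁻ (subst (_ ⊆_) (sym (++-assoc β (reverse β) _)) s″))
  ... | inj₂ s‴ = ⊥-elim (x∉α (Any.reverse⁻ (to∈ (∷ˡ⁻ (∷ʳ⁻ (<⇒≢ a<x) s‴)))))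

occurrence-insert⁻ : ∀ {x} α β → Below x (α ++ β) →
  Occurrence1432 (mirror (α ++ x ∷ β)) →
  Occurrence1432 (mirror (α ++ β)) ⊎ AscentOver α β ⊎ Straddle α β
occurrence-insert⁻ {x} α β below (occurrence {a} {b} {c} {d} a<b b<c c<d s) with d ≟ x
... | yes refl = inj₂ (occurrence-of-max α β below a<b b<c c<d s)
... | no d≢x   = inj₁ (occurrence a<b b<c c<d (mirror-remove α β (below⇒∉ occurrence<x) s))
  where
  d<x : d < x
  d<x = below (∈-insert⁻ α (∈-mirror⁻ (α ++ x ∷ β) (to∈ (∷ˡ⁻ s))) d≢x)
  occurrence<x : Below x (a ∷ d ∷ c ∷ b ∷ [])
  occurrence<x (here refl)                 = <-trans (<-trans a<b (<-trans b<c c<d)) d<x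
  occurrence<x (there (here refl))         = d<x
  occurrence<x (there (there (here refl))) = <-trans c<d d<x
  occurrence<x (there (there (there (here refl)))) = <-trans (<-trans b<c c<d) d<x

mirrorAvoids-delete : ∀ {x} α β → Below x (α ++ β) → MirrorAvoids (α ++ x ∷ β) → MirrorAvoids (α ++ β)
mirrorAvoids-delete α β below av = av ∘ occurrence-insert⁺ α β below ∘ inj₁

ascentOver⇒¬mirrorAvoids : ∀ {x} α β → Below x (α ++ β) → AscentOver α β → ¬ MirrorAvoids (α ++ x ∷ β)
ascentOver⇒¬mirrorAvoids α β below asc av = av (occurrence-insert⁺ α β below (inj₂ (inj₁ asc)))

straddle⇒¬mirrorAvoids : ∀ {x} α β → Below x (α ++ β) → Straddle α β → ¬ MirrorAvoids (α ++ x ∷ β)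
straddle⇒¬mirrorAvoids α β below str av = av (occurrence-insert⁺ α β below (inj₂ (inj₂ str)))

mirrorAvoids-insert⁺ : ∀ {x} α β → Below x (α ++ β) →
  MirrorAvoids (α ++ β) → ¬ AscentOver α β → ¬ Straddle α β → MirrorAvoids (α ++ x ∷ β)
mirrorAvoids-insert⁺ α β below av ¬asc ¬str occ =
  Sum.[ av , Sum.[ ¬asc , ¬str ] ] (occurrence-insert⁻ α β below occ)

mirrorAvoids-cons : ∀ {x} τ → Below x τ → MirrorAvoids τ → MirrorAvoids (x ∷ τ)
mirrorAvoids-cons τ below av = mirrorAvoids-insert⁺ [] τ below av (λ ()) (λ ())

record IsPermutation (m : ℕ) (w : List ℕ) : Set where
  field
    bounded  : ∀ {v} → v ∈ w → v ≤ m
    complete : ∀ {v} → 1 ≤ v → v ≤ m → v ∈ w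
    unique   : Unique w

open IsPermutation

below-suc : ∀ {m τ} → IsPermutation m τ → Below (suc m) τ
below-suc π = s≤s ∘ bounded π

isPermutation-insert : ∀ {m} p q → IsPermutation m (p ++ q) → IsPermutation (suc m) (p ++ suc m ∷ q)
isPermutation-insert {m} p q π = record
  { bounded  = bounded′
  ; complete = complete′
  ; unique   = unique-insert p (below⇒∉ (below-suc π)) (unique π)
  }
  where
  bounded′ : ∀ {v} → v ∈ p ++ suc m ∷ q → v ≤ suc m
  bounded′ {v} v∈ with v ≟ suc m
  ... | yes refl = ≤-refl
  ... | no v≢    = m≤n⇒m≤1+n (bounded π (∈-insert⁻ p v∈ v≢))
  complete′ : ∀ {v} → 1 ≤ v → v ≤ suc m → v ∈ p ++ suc m ∷ q
  complete′ {v} 1≤v v≤ with v ≟ suc m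
  ... | yes refl = ∈-++⁺ʳ p (here refl)
  ... | no v≢    = ∈-insert⁺ p (complete π 1≤v (≤-pred (≤∧≢⇒< v≤ v≢)))

insertions-splits : ∀ x τ → insertions x τ ≡ map (plug x) (splits τ)
insertions-splits x []       = refl
insertions-splits x (y ∷ ys) = cong ((x ∷ y ∷ ys) ∷_) (begin
  map (y ∷_) (insertions x ys)                   ≡⟨ cong (map (y ∷_)) (insertions-splits x ys) ⟩
  map (y ∷_) (map (plug x) (splits ys))          ≡⟨ map-∘ (splits ys) ⟨
  map (plug x ∘ map₁ (y ∷_)) (splits ys)         ≡⟨ map-∘ (splits ys) ⟩
  map (plug x) (map (map₁ (y ∷_)) (splits ys))   ∎)
  where open ≡-Reasoning

splits-++ : ∀ {p q} (τ : List A) → (p , q) ∈ splits τ → p ++ q ≡ τ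
splits-++ []       (here refl) = refl
splits-++ (y ∷ ys) (here refl) = refl
splits-++ (y ∷ ys) (there s∈) with ∈-map⁻ (map₁ (y ∷_)) s∈
... | _ , s′∈ , refl = cong (y ∷_) (splits-++ ys s′∈)

∈-insertions⁻ : ∀ {κ} x τ → κ ∈ insertions x τ → ∃₂ λ p q → p ++ q ≡ τ × κ ≡ p ++ x ∷ q
∈-insertions⁻ x τ κ∈ with ∈-map⁻ (plug x) (subst (_ ∈_) (insertions-splits x τ) κ∈)
... | (p , q) , s∈ , refl = p , q , splits-++ τ s∈ , refl

S⇒isPermutation : ∀ {m τ} → τ ∈ S m → IsPermutation m τ
S⇒isPermutation {zero} (here refl) = record
  { bounded = λ () ; complete = λ 1≤v v≤0 → ⊥-elim (<-irrefl refl (≤-trans 1≤v v≤0)) ; unique = [] }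
S⇒isPermutation {suc m} κ∈ with ∈-concat⁻′ (map (insertions (suc m)) (S m)) κ∈
... | _ , κ∈′ , ins∈ with ∈-map⁻ (insertions (suc m)) ins∈
... | τ , τ∈ , refl with ∈-insertions⁻ (suc m) τ κ∈′
... | p , q , refl , refl = isPermutation-insert p q (S⇒isPermutation τ∈)

∑ : (A → ℕ) → List A → ℕ
∑ f L = sum (map f L)

∑-++ : ∀ (f : A → ℕ) L M → ∑ f (L ++ M) ≡ ∑ f L + ∑ f M
∑-++ f L M = trans (cong sum (map-++ f L M)) (sum-++ (map f L) (map f M))

∑-concatMap : ∀ (f : B → ℕ) (g : A → List B) L → ∑ f (concatMap g L) ≡ ∑ (∑ f ∘ g) L
∑-concatMap f g []      = refl
∑-concatMap f g (b ∷ L) = trans (∑-++ f (g b) (concatMap g L)) (cong (∑ f (g b) +_) (∑-concatMap f g L))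

∑-map : ∀ (f : B → ℕ) (g : A → B) L → ∑ f (map g L) ≡ ∑ (f ∘ g) L
∑-map f g L = cong sum (sym (map-∘ L))

∑-cong : ∀ {f g : A → ℕ} L → (∀ {b} → b ∈ L → f b ≡ g b) → ∑ f L ≡ ∑ g L
∑-cong []      _  = refl
∑-cong (b ∷ L) eq = cong₂ _+_ (eq (here refl)) (∑-cong L (eq ∘ there))

∑-zero : ∀ {f : A → ℕ} L → (∀ {b} → b ∈ L → f b ≡ 0) → ∑ f L ≡ 0
∑-zero []      _  = refl
∑-zero (b ∷ L) eq = cong₂ _+_ (eq (here refl)) (∑-zero L (eq ∘ there))

∑-+ : ∀ (f g : A → ℕ) L → ∑ (λ b → f b + g b) L ≡ ∑ f L + ∑ g L
∑-+ f g []      = refl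
∑-+ f g (b ∷ L) rewrite ∑-+ f g L = +-comm-middle (f b) (g b) (∑ f L) (∑ g L)
  where
  +-comm-middle : ∀ a b c d → (a + b) + (c + d) ≡ (a + c) + (b + d)
  +-comm-middle = solve-∀

∑-* : ∀ k (f : A → ℕ) L → ∑ (λ b → k * f b) L ≡ k * ∑ f L
∑-* k f []      = sym (*-zeroʳ k)
∑-* k f (b ∷ L) rewrite ∑-* k f L = sym (*-distribˡ-+ k (f b) (∑ f L))

indicator : ∀ {P : Set} → Dec P → ℕ
indicator (yes _) = 1
indicator (no _)  = 0

length-filter≡∑ : ∀ {P : A → Set} (P? : ∀ a → Dec (P a)) L →
  length (filter P? L) ≡ ∑ (indicator ∘ P?) L
length-filter≡∑ P? []      = refl
length-filter≡∑ P? (b ∷ L) with P? b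
... | yes _ = cong suc (length-filter≡∑ P? L)
... | no _  = length-filter≡∑ P? L

χ : List ℕ → ℕ
χ w = indicator (avoids? (mirror w) ρ)

r≡∑χ : ∀ n → r n ρ ≡ ∑ χ (S n)
r≡∑χ n = length-filter≡∑ (λ π → avoids? (mirror π) ρ) (S n)

avoids⇔mirrorAvoids : ∀ w → Avoids (mirror w) ρ ⇔ MirrorAvoids w
avoids⇔mirrorAvoids w = mk⇔ (λ av → av ∘ Equivalence.from occ⇔) (λ av → av ∘ Equivalence.to occ⇔)
  where occ⇔ = contains⇔occurrence (mirror w)

mirrorAvoids? : ∀ w → Dec (MirrorAvoids w)
mirrorAvoids? w = map′ (Equivalence.to (avoids⇔mirrorAvoids w)) (Equivalence.from (avoids⇔mirrorAvoids w))
                       (avoids? (mirror w) ρ)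

χ-avoiding : ∀ w → MirrorAvoids w → χ w ≡ 1
χ-avoiding w av with avoids? (mirror w) ρ
... | yes _  = refl
... | no ¬av = ⊥-elim (¬av (Equivalence.from (avoids⇔mirrorAvoids w) av))

χ-nonavoiding : ∀ w → ¬ MirrorAvoids w → χ w ≡ 0
χ-nonavoiding w ¬av with avoids? (mirror w) ρ
... | yes av = ⊥-elim (¬av (Equivalence.to (avoids⇔mirrorAvoids w) av))
... | no _   = refl

χ-cong : ∀ u v → (MirrorAvoids u → MirrorAvoids v) → (MirrorAvoids v → MirrorAvoids u) → χ u ≡ χ v
χ-cong u v u⇒v v⇒u with mirrorAvoids? u
... | yes av = trans (χ-avoiding u av) (sym (χ-avoiding v (u⇒v av)))
... | no ¬av = trans (χ-nonavoiding u ¬av) (sym (χ-nonavoiding v (¬av ∘ v⇒u)))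

childCount : ℕ → List ℕ → ℕ
childCount m τ = ∑ χ (insertions (suc m) τ)

χ-max-first : ℕ → List ℕ → ℕ
χ-max-first m []      = 0
χ-max-first m (y ∷ τ) = χ (y ∷ τ) * indicator (y ≟ m)

isOne : ℕ → ℕ
isOne 1 = 1
isOne _ = 0

χ-one-child : ℕ → List ℕ → ℕ
χ-one-child m τ = isOne (childCount m τ)

-- Children of an avoiding permutation

isPermutation-child : ∀ {m τ κ} → IsPermutation m τ → κ ∈ insertions (suc m) τ → IsPermutation (suc m) κ
isPermutation-child {m} {τ} π κ∈ with ∈-insertions⁻ (suc m) τ κ∈
... | p , q , refl , refl = isPermutation-insert p q π

mirrorAvoids-parent : ∀ {m τ κ} → IsPermutation m τ → κ ∈ insertions (suc m) τ → MirrorAvoids κ → MirrorAvoids τ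
mirrorAvoids-parent {m} {τ} π κ∈ with ∈-insertions⁻ (suc m) τ κ∈
... | p , q , refl , refl = mirrorAvoids-delete p q (below-suc π)

childCount-nonavoiding : ∀ {m τ} → IsPermutation m τ → ¬ MirrorAvoids τ → childCount m τ ≡ 0
childCount-nonavoiding {m} {τ} π ¬av =
  ∑-zero (insertions (suc m) τ) (λ {κ} κ∈ → χ-nonavoiding κ (¬av ∘ mirrorAvoids-parent π κ∈))

module _ {m} p q (π : IsPermutation m (p ++ q)) where
  private
    x : ℕ
    x = suc m
    X : ℕ
    X = suc x
    below-x : Below x (p ++ q)
    below-x = below-suc π
    below-X : Below X (x ∷ p ++ q)
    below-X (here refl) = ≤-refl
    below-X (there v∈) = m≤n⇒m≤1+n (below-x v∈)

  mirrorAvoids-shift⁻ : MirrorAvoids (x ∷ p ++ X ∷ q) → MirrorAvoids (p ++ x ∷ q)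
  mirrorAvoids-shift⁻ av = mirrorAvoids-insert⁺ p q below-x
    (mirrorAvoids-delete [] (p ++ q) below-x (mirrorAvoids-delete (x ∷ p) q below-X av))
    (λ { (ascentOver a<b b<c asc a∈) → ascentOver⇒¬mirrorAvoids (x ∷ p) q below-X (ascentOver a<b b<c (x ∷ʳ asc) (there a∈)) av })
    (λ { (straddle a<b b<c a∈α c∈β b∈) → straddle⇒¬mirrorAvoids (x ∷ p) q below-X (straddle a<b b<c (there a∈α) c∈β (there b∈)) av })

  mirrorAvoids-shift⁺ : MirrorAvoids (p ++ x ∷ q) → MirrorAvoids (x ∷ p ++ X ∷ q)
  mirrorAvoids-shift⁺ av = mirrorAvoids-insert⁺ (x ∷ p) q below-X
    (mirrorAvoids-cons (p ++ q) below-x (mirrorAvoids-delete p q below-x av)) ¬ascent ¬straddle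
    where
    ¬ascent : ¬ AscentOver (x ∷ p) q
    ¬ascent (ascentOver a<b b<c (refl ∷ c∈) _)       = <-asym b<c (below-x (∈-++⁺ˡ (to∈ c∈)))
    ¬ascent (ascentOver a<b b<c (_ ∷ʳ asc) (here refl)) = <-asym a<b (below-x (∈-++⁺ˡ (to∈ asc)))
    ¬ascent (ascentOver a<b b<c (_ ∷ʳ asc) (there a∈)) =
      ascentOver⇒¬mirrorAvoids p q below-x (ascentOver a<b b<c asc a∈) av
    ¬straddle : ¬ Straddle (x ∷ p) q
    ¬straddle (straddle a<b b<c (here refl) c∈β (here refl)) = <-irrefl refl a<b
    ¬straddle (straddle a<b b<c (here refl) c∈β (there b∈)) = <-asym a<b (below-x b∈)
    ¬straddle (straddle a<b b<c (there a∈α) c∈β (here refl)) = <-asym b<c (below-x (∈-++⁺ʳ p c∈β))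
    ¬straddle (straddle a<b b<c (there a∈α) c∈β (there b∈)) =
      straddle⇒¬mirrorAvoids p q below-x (straddle a<b b<c a∈α c∈β b∈) av

childCount-cons-max : ∀ {m τ} → IsPermutation m τ → MirrorAvoids τ →
  childCount (suc m) (suc m ∷ τ) ≡ suc (childCount m τ)
childCount-cons-max {m} {τ} π av = cong₂ _+_ (χ-avoiding (X ∷ x ∷ τ) avoids-first) (begin
  ∑ χ (map (x ∷_) (insertions X τ))              ≡⟨ cong (∑ χ ∘ map (x ∷_)) (insertions-splits X τ) ⟩
  ∑ χ (map (x ∷_) (map (plug X) (splits τ)))     ≡⟨ ∑-map χ (x ∷_) (map (plug X) (splits τ)) ⟩
  ∑ (χ ∘ (x ∷_)) (map (plug X) (splits τ))       ≡⟨ ∑-map (χ ∘ (x ∷_)) (plug X) (splits τ) ⟩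
  ∑ (χ ∘ (x ∷_) ∘ plug X) (splits τ)             ≡⟨ ∑-cong (splits τ) shift ⟩
  ∑ (χ ∘ plug x) (splits τ)                      ≡⟨ ∑-map χ (plug x) (splits τ) ⟨
  ∑ χ (map (plug x) (splits τ))                  ≡⟨ cong (∑ χ) (insertions-splits x τ) ⟨
  ∑ χ (insertions x τ)                           ∎)
  where
  open ≡-Reasoning
  x = suc m
  X = suc x
  avoids-first : MirrorAvoids (X ∷ x ∷ τ)
  avoids-first = mirrorAvoids-cons (x ∷ τ) (below-suc (isPermutation-insert [] τ π))
                   (mirrorAvoids-cons τ (below-suc π) av)
  shift : ∀ {s : List ℕ × List ℕ} → s ∈ splits τ → χ (x ∷ plug X s) ≡ χ (plug x s)
  shift {p , q} s∈ with splits-++ τ s∈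
  ... | refl = χ-cong (x ∷ p ++ X ∷ q) (p ++ x ∷ q) (mirrorAvoids-shift⁻ p q π) (mirrorAvoids-shift⁺ p q π)

laterInsertions : ℕ → ℕ → ℕ → List ℕ → List (List ℕ)
laterInsertions x y z τ = map (y ∷_) (map (z ∷_) (insertions x τ))

∈-laterInsertions⁻ : ∀ {κ x y z} τ → κ ∈ laterInsertions x y z τ →
  ∃₂ λ p q → p ++ q ≡ τ × κ ≡ y ∷ z ∷ p ++ x ∷ q
∈-laterInsertions⁻ {x = x} {y} {z} τ κ∈ with ∈-map⁻ (y ∷_) κ∈
... | _ , κ∈′ , refl with ∈-map⁻ (z ∷_) κ∈′
... | _ , κ∈″ , refl with ∈-insertions⁻ x τ κ∈″
... | p , q , eq , refl = p , q , eq , refl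

mirrorAvoids-insert-second : ∀ {x y} β → Below x (y ∷ β) → (∀ {c} → c ∈ β → c ≤ suc y) →
  MirrorAvoids (y ∷ β) → MirrorAvoids (y ∷ x ∷ β)
mirrorAvoids-insert-second {y = y} β below β≤ av = mirrorAvoids-insert⁺ (y ∷ []) β below av ¬ascent ¬straddle
  where
  ¬ascent : ¬ AscentOver (y ∷ []) β
  ¬ascent (ascentOver _ _ (refl ∷ ()) _)
  ¬ascent (ascentOver _ _ (_ ∷ʳ ()) _)
  ¬straddle : ¬ Straddle (y ∷ []) β
  ¬straddle (straddle a<b b<c (here refl) c∈β _) = <⇒≱ (≤-trans (s≤s a<b) b<c) (β≤ c∈β)

mirrorAvoids-max-second⇒ : ∀ {m y ys} → IsPermutation m (y ∷ ys) → MirrorAvoids (y ∷ suc m ∷ ys) → m ≤ suc y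
mirrorAvoids-max-second⇒ {m} {y} {ys} π av with m ≤? suc y
... | yes m≤1+y = m≤1+y
... | no m≰1+y  = ⊥-elim (straddle⇒¬mirrorAvoids (y ∷ []) ys (below-suc π)
                    (straddle ≤-refl 1+y<m (here refl) m∈ys (complete π (s≤s z≤n) (<⇒≤ 1+y<m))) av)
  where
  1+y<m : suc y < m
  1+y<m = ≰⇒> m≰1+y
  m∈ys : m ∈ ys
  m∈ys with complete π (≤-trans (s≤s z≤n) 1+y<m) ≤-refl
  ... | here m≡y = ⊥-elim (<-irrefl (sym m≡y) (<-trans (n<1+n y) 1+y<m))
  ... | there m∈ = m∈

later-after-second-max-blocked : ∀ {m z} p q → 2 ≤ m → IsPermutation (suc m) (m ∷ z ∷ p ++ q) →
  ¬ MirrorAvoids (m ∷ z ∷ p ++ suc (suc m) ∷ q)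
later-after-second-max-blocked {m} {z} p q 2≤m π with complete π (s≤s z≤n) ≤-refl
... | here m+1≡m = ⊥-elim (<-irrefl (sym m+1≡m) ≤-refl)
... | there x∈ with ∈-++⁻ (z ∷ p) x∈
...   | inj₁ x∈zp = ascentOver⇒¬mirrorAvoids (m ∷ z ∷ p) q (below-suc π)
                      (ascentOver 2≤m ≤-refl (refl ∷ from∈ x∈zp) (complete π ≤-refl (s≤s z≤n)))
...   | inj₂ x∈q  = straddle⇒¬mirrorAvoids (m ∷ z ∷ p) q (below-suc π)
                      (straddle ≤-refl (s≤s z<m) (there (here refl)) x∈q
                        (complete π (s≤s z≤n) (s≤s (<⇒≤ z<m))))
  where
  z<m : z < m
  z<m with unique π
  ... | m∉ ∷ z∉ ∷ _ = ≤∧≢⇒< (≤-pred (≤∧≢⇒< (bounded π (there (here refl))) z≢m+1)) (λ z≡m → All.All¬⇒¬Any m∉ (here (sym z≡m)))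
    where
    z≢m+1 : z ≢ suc m
    z≢m+1 refl = All.All¬⇒¬Any z∉ (∈-++⁺ʳ p x∈q)

childCount-second-max-first : ∀ {m z rest} → 2 ≤ m → IsPermutation (suc m) (m ∷ z ∷ rest) →
  MirrorAvoids (m ∷ z ∷ rest) → childCount (suc m) (m ∷ z ∷ rest) ≡ 2
childCount-second-max-first {m} {z} {rest} 2≤m π av =
  cong₂ _+_ (χ-avoiding (X ∷ m ∷ z ∷ rest) (mirrorAvoids-cons (m ∷ z ∷ rest) (below-suc π) av))
    (cong₂ _+_ (χ-avoiding (m ∷ X ∷ z ∷ rest) (mirrorAvoids-insert-second (z ∷ rest) (below-suc π) (bounded π ∘ there) av))
               (∑-zero (laterInsertions X m z rest) later-blocked))
  where
  X = suc (suc m)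
  later-blocked : ∀ {κ} → κ ∈ laterInsertions X m z rest → χ κ ≡ 0
  later-blocked {κ} κ∈ with ∈-laterInsertions⁻ rest κ∈
  ... | p , q , p++q≡rest , refl = χ-nonavoiding κ
    (later-after-second-max-blocked p q 2≤m (subst (λ t → IsPermutation (suc m) (m ∷ z ∷ t)) (sym p++q≡rest) π))

childCount-max-second : ∀ {m y ys} → 4 ≤ m → y ≢ m → IsPermutation m (y ∷ ys) →
  MirrorAvoids (y ∷ suc m ∷ ys) → childCount (suc m) (y ∷ suc m ∷ ys) ≡ 1
childCount-max-second {m} {y} {ys} 4≤m y≢m π av =
  cong₂ _+_ (χ-avoiding (X ∷ y ∷ x ∷ ys) (mirrorAvoids-cons (y ∷ x ∷ ys) (below-suc π′) av))
    (cong₂ _+_ (χ-nonavoiding (y ∷ X ∷ x ∷ ys) second-blocked)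
               (∑-zero (laterInsertions X y x ys) later-blocked))
  where
  x = suc m
  X = suc x
  π′ : IsPermutation x (y ∷ x ∷ ys)
  π′ = isPermutation-insert (y ∷ []) ys π
  y<m : y < m
  y<m = ≤∧≢⇒< (bounded π (here refl)) y≢m
  second-blocked : ¬ MirrorAvoids (y ∷ X ∷ x ∷ ys)
  second-blocked = straddle⇒¬mirrorAvoids (y ∷ []) (x ∷ ys) (below-suc π′)
    (straddle ≤-refl (s≤s y<m) (here refl) (here refl) (complete π′ (s≤s z≤n) (s≤s (<⇒≤ y<m))))
  1<y : 1 < y
  1<y = ≤-trans (s≤s (s≤s z≤n)) (≤-pred (≤-trans 4≤m (mirrorAvoids-max-second⇒ π av)))
  later-blocked : ∀ {κ} → κ ∈ laterInsertions X y x ys → χ κ ≡ 0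
  later-blocked {κ} κ∈ with ∈-laterInsertions⁻ ys κ∈
  ... | p , q , p++q≡ys , refl = χ-nonavoiding κ (ascentOver⇒¬mirrorAvoids (y ∷ x ∷ p) q (below-suc π″)
          (ascentOver 1<y (s≤s (<⇒≤ y<m)) (refl ∷ from∈ (here refl)) (complete π″ ≤-refl (s≤s z≤n))))
    where
    π″ : IsPermutation x (y ∷ x ∷ p ++ q)
    π″ = subst (λ t → IsPermutation x (y ∷ x ∷ t)) (sym p++q≡ys) π′

later-insertion⇒max-first : ∀ {m y z} p q → 4 ≤ m → IsPermutation m (y ∷ z ∷ p ++ q) →
  MirrorAvoids (y ∷ z ∷ p ++ q) → MirrorAvoids (y ∷ z ∷ p ++ suc m ∷ q) → y ≡ m
later-insertion⇒max-first {zero} p q () _ _ _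
later-insertion⇒max-first {m@(suc m′)} {y} {z} p q 4≤m π avτ avκ with y ≟ m
... | yes y≡m = y≡m
... | no y≢m with complete π (s≤s z≤n) ≤-refl
...   | here m≡y = ⊥-elim (y≢m (sym m≡y))
...   | there m∈ = ⊥-elim (Sum.[ max-early , max-late ] (∈-++⁻ (z ∷ p) m∈))
  where
  y<m : y < m
  y<m = ≤∧≢⇒< (bounded π (here refl)) y≢m
  2<m′ : 2 < m′
  2<m′ = ≤-pred 4≤m
  2∈ : 2 ∈ y ∷ z ∷ p ++ q
  2∈ = complete π (s≤s z≤n) (≤-trans (n≤1+n 2) (<⇒≤ 4≤m))
  ¬ascent : ¬ AscentOver (y ∷ z ∷ p) q
  ¬ascent asc = ascentOver⇒¬mirrorAvoids (y ∷ z ∷ p) q (below-suc π) asc avκ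
  ¬straddle : ¬ Straddle (y ∷ z ∷ p) q
  ¬straddle str = straddle⇒¬mirrorAvoids (y ∷ z ∷ p) q (below-suc π) str avκ
  max-early : m ∈ z ∷ p → ⊥
  -- For y ≤ 1 the ascent y m is no obstruction; the position of m′ = m - 1 is.
  max-early m∈zp with 2 ≤? y
  ... | yes 1<y = ¬ascent (ascentOver 1<y y<m (refl ∷ from∈ m∈zp) (complete π ≤-refl (s≤s z≤n)))
  ... | no 1≮y with complete π (≤-trans (s≤s z≤n) 2<m′) (n≤1+n m′)
  ...   | here m′≡y = <⇒≱ (≤-trans (≰⇒> 1≮y) (<⇒≤ 2<m′)) (≤-reflexive m′≡y)
  ...   | there m′∈ with ∈-++⁻ (z ∷ p) m′∈
  ...     | inj₂ m′∈q  = ¬straddle (straddle (≰⇒> 1≮y) 2<m′ (here refl) m′∈q 2∈)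
  ...     | inj₁ m′∈zp with distinct-∈⇒⊆ m′∈zp m∈zp (<⇒≢ (n<1+n m′))
  ...       | inj₁ m′m = ¬ascent (ascentOver (<-trans (≰⇒> 1≮y) 2<m′) (n<1+n m′) (y ∷ʳ m′m) (here refl))
  ...       | inj₂ mm′ = avτ (occurrence (≰⇒> 1≮y) 2<m′ (n<1+n m′)
                           (++⁺ (refl ∷ ++⁺ʳ q mm′) (from∈ (Any.reverse⁺ 2∈))))
  max-late : m ∈ q → ⊥
  -- The straddles y (y+1) m and z (z+1) m leave only y = z = m - 1.
  max-late m∈q with suc (suc y) ≤? m | suc (suc z) ≤? m
  ... | yes 2+y≤m | _ = ¬straddle (straddle ≤-refl 2+y≤m (here refl) m∈q (complete π (s≤s z≤n) (<⇒≤ 2+y≤m)))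
  ... | _ | yes 2+z≤m = ¬straddle (straddle ≤-refl 2+z≤m (there (here refl)) m∈q (complete π (s≤s z≤n) (<⇒≤ 2+z≤m)))
  ... | no 2+y≰m | no 2+z≰m with unique π
  ...   | y∉ ∷ z∉ ∷ _ = All.All¬⇒¬Any y∉ (here (suc-injective (trans (1+y≡m) (sym 1+z≡m))))
    where
    z≢m : z ≢ m
    z≢m refl = All.All¬⇒¬Any z∉ (∈-++⁺ʳ p m∈q)
    1+y≡m : suc y ≡ m
    1+y≡m = ≤-antisym y<m (≤-pred (≰⇒> 2+y≰m))
    1+z≡m : suc z ≡ m
    1+z≡m = ≤-antisym (≤∧≢⇒< (bounded π (there (here refl))) z≢m) (≤-pred (≰⇒> 2+z≰m))

laterInsertions-avoiding : ∀ {m y z zs κ} → 4 ≤ m → IsPermutation m (y ∷ z ∷ zs) → MirrorAvoids (y ∷ z ∷ zs) →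
  κ ∈ laterInsertions (suc m) y z zs → MirrorAvoids κ → y ≡ m × childCount (suc m) κ ≡ 2
laterInsertions-avoiding {zs = zs} 4≤m π av κ∈ avκ with ∈-laterInsertions⁻ zs κ∈
... | p , q , refl , refl with later-insertion⇒max-first p q 4≤m π av avκ
... | refl = refl , childCount-second-max-first (≤-trans (s≤s (s≤s z≤n)) 4≤m)
                      (isPermutation-insert (_ ∷ _ ∷ p) q π) avκ

χ-max-first-nonavoiding : ∀ {m τ} → ¬ MirrorAvoids τ → χ-max-first m τ ≡ 0
χ-max-first-nonavoiding {τ = []}    _   = refl
χ-max-first-nonavoiding {τ = y ∷ τ} ¬av = cong (_* _) (χ-nonavoiding (y ∷ τ) ¬av)

χ-max-first-other : ∀ {m y} τ → y ≢ m → χ-max-first m (y ∷ τ) ≡ 0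
χ-max-first-other {m} {y} τ y≢m with y ≟ m
... | yes y≡m = ⊥-elim (y≢m y≡m)
... | no _    = *-zeroʳ (χ (y ∷ τ))

record LocalIdentities (m : ℕ) (τ : List ℕ) : Set where
  field
    childCounts : ∑ (childCount (suc m)) (insertions (suc m) τ) + 2 * χ τ
                ≡ 3 * childCount m τ + χ-max-first m τ + χ-one-child m τ
    maxFirsts   : ∑ (χ-max-first (suc m)) (insertions (suc m) τ) ≡ χ τ
    oneChilds   : ∑ (χ-one-child (suc m)) (insertions (suc m) τ) + χ-one-child m τ + χ-max-first m τ ≡ χ τ

module AvoidingChildren {m} (4≤m : 4 ≤ m) {y z zs} (π : IsPermutation m (y ∷ z ∷ zs))
                        (av : MirrorAvoids (y ∷ z ∷ zs)) where
  x : ℕ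
  x = suc m
  κ₁ : List ℕ
  κ₁ = y ∷ x ∷ z ∷ zs
  R : List (List ℕ)
  R = laterInsertions x y z zs
  k : ℕ
  k = ∑ χ R

  isPermutation-κ₁ : IsPermutation x κ₁
  isPermutation-κ₁ = isPermutation-insert (y ∷ []) (z ∷ zs) π

  childCount-τ : childCount m (y ∷ z ∷ zs) ≡ suc (χ κ₁ + k)
  childCount-τ = cong (_+ (χ κ₁ + k)) (χ-avoiding (x ∷ y ∷ z ∷ zs) (mirrorAvoids-cons (y ∷ z ∷ zs) (below-suc π) av))

  childCount-κ₀ : childCount x (x ∷ y ∷ z ∷ zs) ≡ suc (childCount m (y ∷ z ∷ zs))
  childCount-κ₀ = childCount-cons-max π av

  χ-one-child-κ₀ : χ-one-child x (x ∷ y ∷ z ∷ zs) ≡ 0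
  χ-one-child-κ₀ = cong isOne (trans childCount-κ₀ (cong suc childCount-τ))

  y≢x : y ≢ x
  y≢x y≡x = <-irrefl y≡x (s≤s (bounded π (here refl)))

  isPermutation-later : ∀ {κ} → κ ∈ R → IsPermutation x κ
  isPermutation-later κ∈ with ∈-laterInsertions⁻ zs κ∈
  ... | p , q , refl , refl = isPermutation-insert (y ∷ z ∷ p) q π

  childCount-later : ∀ {κ} → κ ∈ R → childCount x κ ≡ 2 * χ κ
  childCount-later {κ} κ∈ with mirrorAvoids? κ
  ... | yes avκ = trans (proj₂ (laterInsertions-avoiding 4≤m π av κ∈ avκ)) (cong (2 *_) (sym (χ-avoiding κ avκ)))
  ... | no ¬avκ = trans (childCount-nonavoiding (isPermutation-later κ∈) ¬avκ) (cong (2 *_) (sym (χ-nonavoiding κ ¬avκ)))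

  χ-later : y ≢ m → ∀ {κ} → κ ∈ R → χ κ ≡ 0
  χ-later y≢m {κ} κ∈ with mirrorAvoids? κ
  ... | yes avκ = ⊥-elim (y≢m (proj₁ (laterInsertions-avoiding 4≤m π av κ∈ avκ)))
  ... | no ¬avκ = χ-nonavoiding κ ¬avκ

  ∑childCount-later : ∑ (childCount x) R ≡ 2 * k
  ∑childCount-later = trans (∑-cong R childCount-later) (∑-* 2 χ R)

  ∑χ-one-child-later : ∑ (χ-one-child x) R ≡ 0
  ∑χ-one-child-later = ∑-zero R one-child
    where
    one-child : ∀ {κ} → κ ∈ R → χ-one-child x κ ≡ 0
    one-child {κ} κ∈ with mirrorAvoids? κ
    ... | yes avκ = cong isOne (proj₂ (laterInsertions-avoiding 4≤m π av κ∈ avκ))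
    ... | no ¬avκ = cong isOne (childCount-nonavoiding (isPermutation-later κ∈) ¬avκ)

  ∑χ-max-first-later : ∑ (χ-max-first x) R ≡ 0
  ∑χ-max-first-later = ∑-zero R max-first
    where
    max-first : ∀ {κ} → κ ∈ R → χ-max-first x κ ≡ 0
    max-first κ∈ with ∈-laterInsertions⁻ zs κ∈
    ... | p , q , _ , refl = χ-max-first-other (z ∷ p ++ x ∷ q) y≢x

  maxFirsts : ∑ (χ-max-first x) (insertions x (y ∷ z ∷ zs)) ≡ χ (y ∷ z ∷ zs)
  maxFirsts = begin
    χ-max-first x (x ∷ y ∷ z ∷ zs) + (χ-max-first x κ₁ + ∑ (χ-max-first x) R)
      ≡⟨ cong₂ _+_ first (cong₂ _+_ (χ-max-first-other (x ∷ z ∷ zs) y≢x) ∑χ-max-first-later) ⟩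
    1 ≡⟨ χ-avoiding (y ∷ z ∷ zs) av ⟨
    χ (y ∷ z ∷ zs) ∎
    where
    open ≡-Reasoning
    first : χ-max-first x (x ∷ y ∷ z ∷ zs) ≡ 1
    first with x ≟ x
    ... | yes _  = trans (*-identityʳ _) (χ-avoiding (x ∷ y ∷ z ∷ zs) (mirrorAvoids-cons (y ∷ z ∷ zs) (below-suc π) av))
    ... | no x≢x = ⊥-elim (x≢x refl)

private
  childCounts-max-first-arith : ∀ {n₀ n₁ nR a N k T E} → n₀ ≡ suc N → N ≡ 2 + k → n₁ ≡ 2 → nR ≡ 2 * k →
    a ≡ 1 → T ≡ 1 → E ≡ 0 → n₀ + (n₁ + nR) + 2 * a ≡ 3 * N + T + E
  childCounts-max-first-arith {k = k} refl refl refl refl refl refl refl = identity k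
    where
    identity : ∀ k → 3 + k + (2 + 2 * k) + 2 * 1 ≡ 3 * (2 + k) + 1 + 0
    identity = solve-∀

  childCounts-two-arith : ∀ {n₀ n₁ nR a N T E} → n₀ ≡ suc N → N ≡ 2 → n₁ ≡ 1 → nR ≡ 0 →
    a ≡ 1 → T ≡ 0 → E ≡ 0 → n₀ + (n₁ + nR) + 2 * a ≡ 3 * N + T + E
  childCounts-two-arith refl refl refl refl refl refl refl = refl

  childCounts-one-arith : ∀ {n₀ n₁ nR a N T E} → n₀ ≡ suc N → N ≡ 1 → n₁ ≡ 0 → nR ≡ 0 →
    a ≡ 1 → T ≡ 0 → E ≡ 1 → n₀ + (n₁ + nR) + 2 * a ≡ 3 * N + T + E
  childCounts-one-arith refl refl refl refl refl refl refl = refl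

  oneChilds-arith : ∀ {E₀ E₁ ER E T a i j l} → E₀ ≡ 0 → ER ≡ 0 → a ≡ 1 →
    E₁ ≡ i → E ≡ j → T ≡ l → i + j + l ≡ 1 → E₀ + (E₁ + ER) + E + T ≡ a
  oneChilds-arith {i = i} refl refl refl refl refl refl sum≡1 = trans (cong (λ e → e + _ + _) (+-identityʳ i)) sum≡1

local-identities-max-first : ∀ {m z zs} → 4 ≤ m → IsPermutation m (m ∷ z ∷ zs) → MirrorAvoids (m ∷ z ∷ zs) →
  LocalIdentities m (m ∷ z ∷ zs)
local-identities-max-first {m} {z} {zs} 4≤m π av = record
  { childCounts = childCounts-max-first-arith childCount-κ₀ N≡2+k n₁≡2 ∑childCount-later χτ≡1 T≡1 E≡0
  ; maxFirsts   = maxFirsts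
  ; oneChilds   = oneChilds-arith χ-one-child-κ₀ ∑χ-one-child-later χτ≡1 (cong isOne n₁≡2) E≡0 T≡1 refl
  }
  where
  open AvoidingChildren 4≤m π av
  χτ≡1 : χ (m ∷ z ∷ zs) ≡ 1
  χτ≡1 = χ-avoiding (m ∷ z ∷ zs) av
  av₁ : MirrorAvoids κ₁
  av₁ = mirrorAvoids-insert-second (z ∷ zs) (below-suc π) (m≤n⇒m≤1+n ∘ bounded π ∘ there) av
  n₁≡2 : childCount x κ₁ ≡ 2
  n₁≡2 = childCount-second-max-first (≤-trans (s≤s (s≤s z≤n)) 4≤m) isPermutation-κ₁ av₁
  N≡2+k : childCount m (m ∷ z ∷ zs) ≡ 2 + k
  N≡2+k = trans childCount-τ (cong (λ c → suc (c + k)) (χ-avoiding κ₁ av₁))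
  T≡1 : χ-max-first m (m ∷ z ∷ zs) ≡ 1
  T≡1 with m ≟ m
  ... | yes _  = trans (*-identityʳ _) χτ≡1
  ... | no m≢m = ⊥-elim (m≢m refl)
  E≡0 : χ-one-child m (m ∷ z ∷ zs) ≡ 0
  E≡0 = cong isOne N≡2+k

module _ {m} (4≤m : 4 ≤ m) {y z zs} (π : IsPermutation m (y ∷ z ∷ zs)) (av : MirrorAvoids (y ∷ z ∷ zs))
         (y≢m : y ≢ m) where
  open AvoidingChildren 4≤m π av

  private
    χτ≡1 : χ (y ∷ z ∷ zs) ≡ 1
    χτ≡1 = χ-avoiding (y ∷ z ∷ zs) av
    k≡0 : k ≡ 0
    k≡0 = ∑-zero R (χ-later y≢m)
    T≡0 : χ-max-first m (y ∷ z ∷ zs) ≡ 0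
    T≡0 = χ-max-first-other (z ∷ zs) y≢m
    ∑childCount-later≡0 : ∑ (childCount x) R ≡ 0
    ∑childCount-later≡0 = trans ∑childCount-later (cong (2 *_) k≡0)

  local-identities-two-children : MirrorAvoids κ₁ → LocalIdentities m (y ∷ z ∷ zs)
  local-identities-two-children av₁ = record
    { childCounts = childCounts-two-arith childCount-κ₀ N≡2 n₁≡1 ∑childCount-later≡0 χτ≡1 T≡0 E≡0
    ; maxFirsts   = maxFirsts
    ; oneChilds   = oneChilds-arith χ-one-child-κ₀ ∑χ-one-child-later χτ≡1 (cong isOne n₁≡1) E≡0 T≡0 refl
    }
    where
    n₁≡1 : childCount x κ₁ ≡ 1
    n₁≡1 = childCount-max-second 4≤m y≢m π av₁
    N≡2 : childCount m (y ∷ z ∷ zs) ≡ 2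
    N≡2 = trans childCount-τ (cong₂ (λ c k′ → suc (c + k′)) (χ-avoiding κ₁ av₁) k≡0)
    E≡0 : χ-one-child m (y ∷ z ∷ zs) ≡ 0
    E≡0 = cong isOne N≡2

  local-identities-one-child : ¬ MirrorAvoids κ₁ → LocalIdentities m (y ∷ z ∷ zs)
  local-identities-one-child ¬av₁ = record
    { childCounts = childCounts-one-arith childCount-κ₀ N≡1 n₁≡0 ∑childCount-later≡0 χτ≡1 T≡0 E≡1
    ; maxFirsts   = maxFirsts
    ; oneChilds   = oneChilds-arith χ-one-child-κ₀ ∑χ-one-child-later χτ≡1 (cong isOne n₁≡0) E≡1 T≡0 refl
    }
    where
    n₁≡0 : childCount x κ₁ ≡ 0
    n₁≡0 = childCount-nonavoiding isPermutation-κ₁ ¬av₁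
    N≡1 : childCount m (y ∷ z ∷ zs) ≡ 1
    N≡1 = trans childCount-τ (cong₂ (λ c k′ → suc (c + k′)) (χ-nonavoiding κ₁ ¬av₁) k≡0)
    E≡1 : χ-one-child m (y ∷ z ∷ zs) ≡ 1
    E≡1 = cong isOne N≡1

local-identities-nonavoiding : ∀ {m τ} → IsPermutation m τ → ¬ MirrorAvoids τ → LocalIdentities m τ
local-identities-nonavoiding {m} {τ} π ¬av = record
  { childCounts = trans (cong₂ (λ s a → s + 2 * a) (∑-zero children childCount-child) χτ≡0)
                        (sym (cong₂ _+_ (cong₂ (λ n t → 3 * n + t) N≡0 T≡0) E≡0))
  ; maxFirsts   = trans (∑-zero children max-first-child) (sym χτ≡0)
  ; oneChilds   = trans (cong₂ _+_ (cong₂ _+_ (∑-zero children one-child-child) E≡0) T≡0) (sym χτ≡0)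
  }
  where
  children = insertions (suc m) τ
  ¬av-child : ∀ {κ} → κ ∈ children → ¬ MirrorAvoids κ
  ¬av-child κ∈ = ¬av ∘ mirrorAvoids-parent π κ∈
  childCount-child : ∀ {κ} → κ ∈ children → childCount (suc m) κ ≡ 0
  childCount-child κ∈ = childCount-nonavoiding (isPermutation-child π κ∈) (¬av-child κ∈)
  max-first-child : ∀ {κ} → κ ∈ children → χ-max-first (suc m) κ ≡ 0
  max-first-child {κ} κ∈ = χ-max-first-nonavoiding {τ = κ} (¬av-child κ∈)
  one-child-child : ∀ {κ} → κ ∈ children → χ-one-child (suc m) κ ≡ 0
  one-child-child κ∈ = cong isOne (childCount-child κ∈)
  χτ≡0 : χ τ ≡ 0
  χτ≡0 = χ-nonavoiding τ ¬av
  N≡0 : childCount m τ ≡ 0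
  N≡0 = childCount-nonavoiding π ¬av
  T≡0 : χ-max-first m τ ≡ 0
  T≡0 = χ-max-first-nonavoiding {τ = τ} ¬av
  E≡0 : χ-one-child m τ ≡ 0
  E≡0 = cong isOne N≡0

local-identities : ∀ {m τ} → 4 ≤ m → IsPermutation m τ → LocalIdentities m τ
local-identities {m} {τ} 4≤m π with mirrorAvoids? τ
... | no ¬av = local-identities-nonavoiding π ¬av
... | yes av = avoiding τ π av
  where
  1≤m : 1 ≤ m
  1≤m = ≤-trans (s≤s z≤n) 4≤m
  avoiding : ∀ τ → IsPermutation m τ → MirrorAvoids τ → LocalIdentities m τ
  avoiding []           π _ with complete π ≤-refl 1≤m
  ... | ()
  avoiding (y ∷ [])     π _ with complete π ≤-refl 1≤m | complete π 1≤m ≤-refl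
  ... | here 1≡y | here m≡y = ⊥-elim (<⇒≢ (≤-trans (s≤s (s≤s z≤n)) 4≤m) (trans 1≡y (sym m≡y)))
  avoiding (y ∷ z ∷ zs) π av with y ≟ m
  ... | yes refl = local-identities-max-first 4≤m π av
  ... | no y≢m with mirrorAvoids? (y ∷ suc m ∷ z ∷ zs)
  ...   | yes av₁ = local-identities-two-children 4≤m π av y≢m av₁
  ...   | no ¬av₁ = local-identities-one-child 4≤m π av y≢m ¬av₁

-- The recurrence

#avoiding #max-first #one-child : ℕ → ℕ
#avoiding m  = ∑ χ (S m)
#max-first m = ∑ (χ-max-first m) (S m)
#one-child m = ∑ (χ-one-child m) (S m)

∑-S-suc : ∀ (f : List ℕ → ℕ) m → ∑ f (S (suc m)) ≡ ∑ (∑ f ∘ insertions (suc m)) (S m)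
∑-S-suc f m = ∑-concatMap f (insertions (suc m)) (S m)

module _ {m} (4≤m : 4 ≤ m) where
  private
    local : ∀ {τ} → τ ∈ S m → LocalIdentities m τ
    local = local-identities 4≤m ∘ S⇒isPermutation
    open LocalIdentities

  childCounts-identity : #avoiding (2 + m) + 2 * #avoiding m ≡ 3 * #avoiding (1 + m) + #max-first m + #one-child m
  childCounts-identity = begin
    #avoiding (2 + m) + 2 * #avoiding m
      ≡⟨ cong₂ _+_ (trans (∑-S-suc χ (suc m)) (∑-S-suc (childCount (suc m)) m)) (sym (∑-* 2 χ (S m))) ⟩
    ∑ (∑ (childCount (suc m)) ∘ insertions (suc m)) (S m) + ∑ (λ τ → 2 * χ τ) (S m)
      ≡⟨ ∑-+ _ _ (S m) ⟨
    ∑ (λ τ → ∑ (childCount (suc m)) (insertions (suc m) τ) + 2 * χ τ) (S m)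
      ≡⟨ ∑-cong (S m) (childCounts ∘ local) ⟩
    ∑ (λ τ → 3 * childCount m τ + χ-max-first m τ + χ-one-child m τ) (S m)
      ≡⟨ ∑-+ _ _ (S m) ⟩
    ∑ (λ τ → 3 * childCount m τ + χ-max-first m τ) (S m) + #one-child m
      ≡⟨ cong (_+ #one-child m) (∑-+ _ _ (S m)) ⟩
    ∑ (λ τ → 3 * childCount m τ) (S m) + #max-first m + #one-child m
      ≡⟨ cong (λ s → s + #max-first m + #one-child m) (∑-* 3 (childCount m) (S m)) ⟩
    3 * ∑ (childCount m) (S m) + #max-first m + #one-child m
      ≡⟨ cong (λ s → 3 * s + #max-first m + #one-child m) (∑-S-suc χ m) ⟨
    3 * #avoiding (1 + m) + #max-first m + #one-child m ∎
    where open ≡-Reasoning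

  maxFirsts-identity : #max-first (suc m) ≡ #avoiding m
  maxFirsts-identity = trans (∑-S-suc (χ-max-first (suc m)) m) (∑-cong (S m) (maxFirsts ∘ local))

  oneChilds-identity : #one-child (suc m) + #one-child m + #max-first m ≡ #avoiding m
  oneChilds-identity = begin
    #one-child (suc m) + #one-child m + #max-first m
      ≡⟨ cong (λ s → s + #one-child m + #max-first m) (∑-S-suc (χ-one-child (suc m)) m) ⟩
    ∑ (∑ (χ-one-child (suc m)) ∘ insertions (suc m)) (S m) + #one-child m + #max-first m
      ≡⟨ cong (_+ #max-first m) (∑-+ _ _ (S m)) ⟨
    ∑ (λ τ → ∑ (χ-one-child (suc m)) (insertions (suc m) τ) + χ-one-child m τ) (S m) + #max-first m
      ≡⟨ ∑-+ _ _ (S m) ⟨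
    ∑ (λ τ → ∑ (χ-one-child (suc m)) (insertions (suc m) τ) + χ-one-child m τ + χ-max-first m τ) (S m)
      ≡⟨ ∑-cong (S m) (oneChilds ∘ local) ⟩
    #avoiding m ∎
    where open ≡-Reasoning

private
  max-first+one-child-identity-step : ∀ a₀ a₁ a₂ T₀ E₀ T₁ E₁ → a₂ + 2 * a₀ ≡ 3 * a₁ + T₀ + E₀ → T₁ ≡ a₀ →
    E₁ + E₀ + T₀ ≡ a₀ → a₂ + T₁ + E₁ ≡ 3 * a₁
  max-first+one-child-identity-step a₀ a₁ a₂ T₀ E₀ .a₀ E₁ h₁ refl h₃ = +-cancelʳ-≡ (E₀ + T₀) _ _ (begin
    a₂ + a₀ + E₁ + (E₀ + T₀)    ≡⟨ shuffle a₂ a₀ E₁ E₀ T₀ ⟩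
    a₂ + a₀ + (E₁ + E₀ + T₀)    ≡⟨ cong (a₂ + a₀ +_) h₃ ⟩
    a₂ + a₀ + a₀                ≡⟨ double a₂ a₀ ⟩
    a₂ + 2 * a₀                 ≡⟨ h₁ ⟩
    3 * a₁ + T₀ + E₀            ≡⟨ swap a₁ T₀ E₀ ⟩
    3 * a₁ + (E₀ + T₀)          ∎)
    where
    open ≡-Reasoning
    shuffle : ∀ a b c d e → a + b + c + (d + e) ≡ a + b + (c + d + e)
    shuffle = solve-∀
    double : ∀ a b → a + b + b ≡ a + 2 * b
    double = solve-∀
    swap : ∀ a b c → 3 * a + b + c ≡ 3 * a + (c + b)
    swap = solve-∀

  recurrence-step : ∀ a₀ a₁ a₂ T E → a₂ + 2 * a₀ ≡ 3 * a₁ + T + E → a₁ + T + E ≡ 3 * a₀ → a₂ ≡ 2 * a₁ + a₀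
  recurrence-step a₀ a₁ a₂ T E h₁ h₂ = +-cancelʳ-≡ (2 * a₀ + (a₁ + T + E)) a₂ (2 * a₁ + a₀) (begin
    a₂ + (2 * a₀ + (a₁ + T + E))        ≡⟨ +-assoc a₂ (2 * a₀) _ ⟨
    a₂ + 2 * a₀ + (a₁ + T + E)          ≡⟨ cong₂ _+_ h₁ h₂ ⟩
    3 * a₁ + T + E + 3 * a₀             ≡⟨ shuffle a₀ a₁ T E ⟩
    2 * a₁ + a₀ + (2 * a₀ + (a₁ + T + E)) ∎)
    where
    open ≡-Reasoning
    shuffle : ∀ a₀ a₁ T E → 3 * a₁ + T + E + 3 * a₀ ≡ 2 * a₁ + a₀ + (2 * a₀ + (a₁ + T + E))
    shuffle = solve-∀

max-first+one-child-identity : ∀ j → #avoiding (5 + j) + #max-first (4 + j) + #one-child (4 + j) ≡ 3 * #avoiding (4 + j)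
max-first+one-child-identity zero    = refl
max-first+one-child-identity (suc j) =
  max-first+one-child-identity-step (#avoiding m) (#avoiding (1 + m)) (#avoiding (2 + m)) (#max-first m) (#one-child m)
    (#max-first (1 + m)) (#one-child (1 + m))
    (childCounts-identity 4≤m) (maxFirsts-identity 4≤m) (oneChilds-identity 4≤m)
  where
  m = 4 + j
  4≤m : 4 ≤ m
  4≤m = m≤m+n 4 j

recurrence : ∀ j → #avoiding (6 + j) ≡ 2 * #avoiding (5 + j) + #avoiding (4 + j)
recurrence j =
  recurrence-step (#avoiding m) (#avoiding (1 + m)) (#avoiding (2 + m)) (#max-first m) (#one-child m)
    (childCounts-identity (m≤m+n 4 j)) (max-first+one-child-identity j)
  where m = 4 + j

theorem13 : (n : ℕ) → 5 ≤ n →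
    r n (1 ∷ 4 ∷ 3 ∷ 2 ∷ []) ≡ 2 * r (n ∸ 1) (1 ∷ 4 ∷ 3 ∷ 2 ∷ []) + r (n ∸ 2) (1 ∷ 4 ∷ 3 ∷ 2 ∷ [])
theorem13 n 5≤n with m≤n⇒∃[o]m+o≡n 5≤n
... | zero  , refl = refl
... | suc j , refl = begin
  r (6 + j) ρ                          ≡⟨ r≡∑χ (6 + j) ⟩
  #avoiding (6 + j)                    ≡⟨ recurrence j ⟩
  2 * #avoiding (5 + j) + #avoiding (4 + j) ≡⟨ cong₂ (λ a b → 2 * a + b) (r≡∑χ (5 + j)) (r≡∑χ (4 + j)) ⟨
  2 * r (5 + j) ρ + r (4 + j) ρ        ∎
  where open ≡-Reasoning
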